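{- Let $\mathcal L$ be a finite modular complemented lattice and let $(\mathcal L,r)$ be an $\mathcal L$-polymatroid. If $C\in\mathcal L$ is cyclic in $(\mathcal L,r)$, then $\mathrm{cl}(C)$ is cyclic.
   Context: $\mathcal H(X)$ is the set of elements covered by $X$, $\mathcal A(X)$ the set of atoms below $X$, and $\mathrm h$ the height. An $\mathcal L$-polymatroid is a pair $(\mathcal L,r)$ with $r:\mathcal L\to\mathbb R$ such that, for some $t\ge0$, $0\le r(A)\le t\,\mathrm h(A)$, $r$ is increasing, and $r(A)-r(A\wedge B)\ge r(A\vee B)-r(B)$ for all $A,B$. Notions for $(\mathcal L,r)$: - $X$ is cyclic if for every $H\in\mathcal H(X)$, either $r(X)=r(H)$, or $0<r(X)-r(H)$ and there is $a\in\mathcal A(X)\setminus\mathcal A(H)$ with $r(X)-r(H)<r(a)$. - $\mathrm{cl}(X)$ is the join of all $x\in\mathcal L$ with $r(X\vee x)=r(X)$. -}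

module Defs where

open import Level using (Level; _⊔_) renaming (suc to lsuc)
open import Data.Nat as ℕ using (ℕ; zero; suc)
open import Data.Fin using (Fin; fromℕ; inject₁) renaming (zero to fzero; suc to fsuc)
open import Data.Product using (Σ; ∃; _×_; _,_)
open import Data.Sum using (_⊎_)
open import Relation.Nullary using (¬_)
open import Relation.Binary.Structures using (IsStrictTotalOrder)
open import Relation.Binary.Lattice.Bundles using (BoundedLattice)
open import Algebra.Bundles using (CommutativeRing)

-- The real numbers, axiomatised as a (Dedekind-)complete ordered field.
-- Any model is isomorphic to ℝ; the theorem is stated for every model.

record RealNumbers (c ℓ : Level) : Set (lsuc (c ⊔ ℓ)) where
  field
    commutativeRing : CommutativeRing c ℓ
  open CommutativeRing commutativeRing public
  infix 4 _<_ _≤_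
  field
    _<_ : Carrier → Carrier → Set ℓ
    <-isStrictTotalOrder : IsStrictTotalOrder _≈_ _<_
    +-mono-< : ∀ x y z → x < y → x + z < y + z
    *-pos : ∀ x y → 0# < x → 0# < y → 0# < x * y
    0≉1 : ¬ (0# ≈ 1#)
    inverse : ∀ x → ¬ (x ≈ 0#) → ∃ λ y → x * y ≈ 1#

  _≤_ : Carrier → Carrier → Set ℓ
  x ≤ y = x < y ⊎ x ≈ y

  field
    complete : (P : Carrier → Set ℓ) → (∃ λ x → P x) →
               (∃ λ b → ∀ x → P x → x ≤ b) →
               ∃ λ s → (∀ x → P x → x ≤ s) ×
                       (∀ b → (∀ x → P x → x ≤ b) → s ≤ b)

  fromℕ' : ℕ → Carrier
  fromℕ' zero = 0#
  fromℕ' (suc n) = 1# + fromℕ' n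

module LatticeNotions {c ℓ₁ ℓ₂ : Level} (L : BoundedLattice c ℓ₁ ℓ₂) where
  open BoundedLattice L

  _<ᴸ_ : Carrier → Carrier → Set (ℓ₁ ⊔ ℓ₂)
  x <ᴸ y = x ≤ y × ¬ (x ≈ y)

  IsModular : Set (c ⊔ ℓ₁ ⊔ ℓ₂)
  IsModular = ∀ x y z → x ≤ z → (x ∨ (y ∧ z)) ≈ ((x ∨ y) ∧ z)

  IsComplemented : Set (c ⊔ ℓ₁)
  IsComplemented = ∀ x → ∃ λ y → ((x ∧ y) ≈ ⊥) × ((x ∨ y) ≈ ⊤)

  IsFinite : Set (c ⊔ ℓ₁)
  IsFinite = ∃ λ n → Σ (Fin n → Carrier) λ e → ∀ x → ∃ λ i → x ≈ e i

  _⋖_ : Carrier → Carrier → Set (c ⊔ ℓ₁ ⊔ ℓ₂)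
  H ⋖ X = H <ᴸ X × (∀ Z → ¬ (H <ᴸ Z × Z <ᴸ X))

  IsAtom : Carrier → Set (c ⊔ ℓ₁ ⊔ ℓ₂)
  IsAtom a = ⊥ ⋖ a

  Chain : Carrier → ℕ → Set (c ⊔ ℓ₁ ⊔ ℓ₂)
  Chain A n = Σ (Fin (suc n) → Carrier) λ ch →
    (ch fzero ≈ ⊥) × (ch (fromℕ n) ≈ A) ×
    (∀ (i : Fin n) → ch (inject₁ i) <ᴸ ch (fsuc i))

  Height : Carrier → ℕ → Set (c ⊔ ℓ₁ ⊔ ℓ₂)
  Height A n = Chain A n × (∀ m → Chain A m → m ℕ.≤ n)

module PolymatroidNotions {c ℓ₁ ℓ₂ c' ℓ' : Level}
         (L : BoundedLattice c ℓ₁ ℓ₂) (R : RealNumbers c' ℓ') where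
  open BoundedLattice L renaming (Carrier to Elt; _≈_ to _≈ᴸ_; _≤_ to _≤ᴸ_)
  open RealNumbers R
  open LatticeNotions L

  record IsPolymatroid (r : Elt → Carrier) : Set (c ⊔ ℓ₁ ⊔ ℓ₂ ⊔ c' ⊔ ℓ') where
    field
      r-cong : ∀ A B → A ≈ᴸ B → r A ≈ r B
      bound : ∃ λ t → (0# ≤ t) ×
                (∀ A n → Height A n → (0# ≤ r A) × (r A ≤ t * fromℕ' n))
      increasing : ∀ A B → A ≤ᴸ B → r A ≤ r B
      submodular : ∀ A B → (r (A ∨ B) - r B) ≤ (r A - r (A ∧ B))

  module _ (r : Elt → Carrier) where

    Cyclic : Elt → Set (c ⊔ ℓ₁ ⊔ ℓ₂ ⊔ ℓ')
    Cyclic X = ∀ H → H ⋖ X →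
      (r X ≈ r H) ⊎
      ((0# < r X - r H) ×
       ∃ λ a → IsAtom a × a ≤ᴸ X × ¬ (a ≤ᴸ H) × (r X - r H < r a))

    IsClosureOf : Elt → Elt → Set (c ⊔ ℓ₂ ⊔ ℓ')
    IsClosureOf X K =
      (∀ x → r (X ∨ x) ≈ r X → x ≤ᴸ K) ×
      (∀ U → (∀ x → r (X ∨ x) ≈ r X → x ≤ᴸ U) → K ≤ᴸ U)

{-# OPTIONS --safe #-}
-- The closure K of C lies above C and has the same rank: by submodularity the
-- join of finitely many elements x with r (C ∨ x) = r C still has rank r C,
-- and in a finite lattice K lies below such a join.  Cyclicity then passes
-- from C to K.  For a lower cover H of K with r H < r K we have C ≰ H, so C ∧ H is
-- a lower cover of C (modularity) and C ∨ H = K; submodularity bounds the jump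
-- r K - r H by r C - r (C ∧ H), and an atom witnessing cyclicity of C at
-- C ∧ H witnesses cyclicity of K at H.
module Submission where

open import Defs
open import Level using (Level)
open import Relation.Binary.Lattice.Bundles using (BoundedLattice)
open import Relation.Binary.Lattice.Bundles using (module BoundedLattice)
open import Data.Nat using (zero; suc)
open import Data.Fin using (Fin) renaming (zero to fzero; suc to fsuc)
open import Data.Product using (∃; ∃-syntax; _×_; _,_)
open import Data.Sum using (_⊎_; inj₁; inj₂)
open import Relation.Nullary using (¬_; yes; no; contradiction)
open import Relation.Nullary.Decidable using (decidable-stable)
open import Relation.Binary.Bundles using (StrictTotalOrder)
import Algebra.Properties.Group as GroupProperties
import Relation.Binary.Properties.StrictTotalOrder as StrictTotalOrderProperties
import Relation.Binary.Reasoning.StrictPartialOrder as StrictReasoning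
import Relation.Binary.Reasoning.PartialOrder as PartialOrderReasoning
import Relation.Binary.Lattice.Properties.JoinSemilattice as JoinSemilatticeProperties

module OrderedFieldProperties {c ℓ} (R : RealNumbers c ℓ) where
  open RealNumbers R

  strictTotalOrder : StrictTotalOrder c ℓ ℓ
  strictTotalOrder = record { isStrictTotalOrder = <-isStrictTotalOrder }

  open StrictTotalOrder strictTotalOrder public using (_≟_)
  open StrictTotalOrder strictTotalOrder using (irrefl)
  open StrictTotalOrderProperties strictTotalOrder public
    using (_≤?_) renaming (antisym to ≤-antisym)
  open StrictReasoning (StrictTotalOrder.strictPartialOrder strictTotalOrder)
  open GroupProperties +-group using (//-rightDividesˡ)

  <⇒≱ : ∀ {x y} → x < y → ¬ (y ≤ x)
  <⇒≱ {x} {y} x<y y≤x = irrefl refl (begin-strict x <⟨ x<y ⟩ y ≤⟨ y≤x ⟩ x ∎)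

  ≤∧≉⇒< : ∀ {x y} → x ≤ y → ¬ (x ≈ y) → x < y
  ≤∧≉⇒< (inj₁ x<y) _   = x<y
  ≤∧≉⇒< (inj₂ x≈y) x≉y = contradiction x≈y x≉y

  +-monoˡ-≤ : ∀ z {x y} → x ≤ y → x + z ≤ y + z
  +-monoˡ-≤ z (inj₁ x<y) = inj₁ (+-mono-< _ _ z x<y)
  +-monoˡ-≤ z (inj₂ x≈y) = inj₂ (+-congʳ x≈y)

  x≤y⇒x-y≤0 : ∀ {x y} → x ≤ y → x - y ≤ 0#
  x≤y⇒x-y≤0 {x} {y} x≤y = begin
    x - y  ≤⟨ +-monoˡ-≤ (- y) x≤y ⟩
    y - y  ≈⟨ -‿inverseʳ y ⟩
    0#     ∎

  x-y≤0⇒x≤y : ∀ {x y} → x - y ≤ 0# → x ≤ y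
  x-y≤0⇒x≤y {x} {y} x-y≤0 = begin
    x            ≈⟨ //-rightDividesˡ y x ⟨
    (x - y) + y  ≤⟨ +-monoˡ-≤ y x-y≤0 ⟩
    0# + y       ≈⟨ +-identityˡ y ⟩
    y            ∎

  x<y⇒0<y-x : ∀ {x y} → x < y → 0# < y - x
  x<y⇒0<y-x {x} {y} x<y = begin-strict
    0#     ≈⟨ -‿inverseʳ x ⟨
    x - x  <⟨ +-mono-< x y (- x) x<y ⟩
    y - x  ∎

module CoveringProperties {c ℓ₁ ℓ₂} (L : BoundedLattice c ℓ₁ ℓ₂) where
  open BoundedLattice L
  open LatticeNotions L
  open PartialOrderReasoning poset

  ⋖-∨-¬¬≈ : ∀ {H K X} → H ⋖ K → X ≤ K → ¬ (X ≤ H) → ¬ ¬ (X ∨ H ≈ K)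
  ⋖-∨-¬¬≈ {H} {K} {X} ((H≤K , _) , no-middle) X≤K X≰H X∨H≉K =
    no-middle (X ∨ H) ((y≤x∨y X H , H≉X∨H) , (∨-least X≤K H≤K , X∨H≉K))
    where
    H≉X∨H : ¬ (H ≈ X ∨ H)
    H≉X∨H H≈X∨H = X≰H (begin X ≤⟨ x≤x∨y X H ⟩ X ∨ H ≈⟨ H≈X∨H ⟨ H ∎)

  modular-≤ : IsModular → ∀ {H X Z} → Z ≤ X → X ∧ H ≤ Z → X ≤ Z ∨ H → X ≤ Z
  modular-≤ modular {H} {X} {Z} Z≤X X∧H≤Z X≤Z∨H = begin
    X            ≤⟨ ∧-greatest X≤Z∨H refl ⟩
    (Z ∨ H) ∧ X  ≈⟨ modular Z H X Z≤X ⟨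
    Z ∨ (H ∧ X)  ≤⟨ ∨-least refl (trans (∧-greatest (x∧y≤y H X) (x∧y≤x H X)) X∧H≤Z) ⟩
    Z            ∎

  -- The interval [X ∧ H, X] embeds into [H, K] by Z ↦ Z ∨ H, so a middle
  -- element of the former would give one of the latter.
  ⋖-∧ : IsModular → ∀ {H K X} → H ⋖ K → X ≤ K → ¬ (X ≤ H) → (X ∧ H) ⋖ X
  ⋖-∧ modular {H} {K} {X} ((H≤K , _) , no-middle) X≤K X≰H =
    (x∧y≤x X H , X∧H≉X) , λ Z (X∧H<Z , Z<X) → no-middle (Z ∨ H) (∨-between X∧H<Z Z<X)
    where
    X∧H≉X : ¬ (X ∧ H ≈ X)
    X∧H≉X X∧H≈X = X≰H (begin X ≈⟨ X∧H≈X ⟨ X ∧ H ≤⟨ x∧y≤y X H ⟩ H ∎)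

    ∨-between : ∀ {Z} → (X ∧ H) <ᴸ Z → Z <ᴸ X → H <ᴸ (Z ∨ H) × (Z ∨ H) <ᴸ K
    ∨-between {Z} (X∧H≤Z , X∧H≉Z) (Z≤X , Z≉X) =
      (y≤x∨y Z H , H≉Z∨H) , (∨-least (trans Z≤X X≤K) H≤K , Z∨H≉K)
      where
      H≉Z∨H : ¬ (H ≈ Z ∨ H)
      H≉Z∨H H≈Z∨H = X∧H≉Z (antisym X∧H≤Z
        (∧-greatest Z≤X (begin Z ≤⟨ x≤x∨y Z H ⟩ Z ∨ H ≈⟨ H≈Z∨H ⟨ H ∎)))

      Z∨H≉K : ¬ (Z ∨ H ≈ K)
      Z∨H≉K Z∨H≈K = Z≉X (antisym Z≤X
        (modular-≤ modular Z≤X X∧H≤Z (begin X ≤⟨ X≤K ⟩ K ≈⟨ Z∨H≈K ⟨ Z ∨ H ∎)))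

module PolymatroidProperties {c ℓ₁ ℓ₂ c' ℓ'}
  (L : BoundedLattice c ℓ₁ ℓ₂) (R : RealNumbers c' ℓ')
  {r : BoundedLattice.Carrier L → RealNumbers.Carrier R}
  (isPolymatroid : PolymatroidNotions.IsPolymatroid L R r) where

  module Lat = BoundedLattice L
  open Lat using (_∨_; _∧_; x≤x∨y; y≤x∨y; ∨-least; ∧-greatest)
    renaming (Carrier to Elt; _≈_ to _≈ᴸ_; _≤_ to _≤ᴸ_)
  open RealNumbers R
  open OrderedFieldProperties R
  open StrictReasoning (StrictTotalOrder.strictPartialOrder strictTotalOrder)
  open LatticeNotions L
  open CoveringProperties L
  open PolymatroidNotions L R
  open IsPolymatroid isPolymatroid
  open JoinSemilatticeProperties Lat.joinSemilattice using (∨-cong; ∨-idempotent)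

  rank-preserving-∨ : ∀ {C A B} → C ≤ᴸ A → C ≤ᴸ B → r A ≈ r C → r B ≈ r C →
                      r (A ∨ B) ≈ r C
  rank-preserving-∨ {C} {A} {B} C≤A C≤B rA≈rC rB≈rC = ≤-antisym r[A∨B]≤rC rC≤r[A∨B]
    where
    rA≤r[A∧B] : r A ≤ r (A ∧ B)
    rA≤r[A∧B] = begin
      r A        ≈⟨ rA≈rC ⟩
      r C        ≤⟨ increasing _ _ (∧-greatest C≤A C≤B) ⟩
      r (A ∧ B)  ∎

    r[A∨B]≤rC : r (A ∨ B) ≤ r C
    r[A∨B]≤rC = begin
      r (A ∨ B)  ≤⟨ x-y≤0⇒x≤y (begin
                     r (A ∨ B) - r B  ≤⟨ submodular A B ⟩
                     r A - r (A ∧ B)  ≤⟨ x≤y⇒x-y≤0 rA≤r[A∧B] ⟩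
                     0#               ∎) ⟩
      r B        ≈⟨ rB≈rC ⟩
      r C        ∎

    rC≤r[A∨B] : r C ≤ r (A ∨ B)
    rC≤r[A∨B] = begin
      r C        ≈⟨ rA≈rC ⟨
      r A        ≤⟨ increasing _ _ (x≤x∨y A B) ⟩
      r (A ∨ B)  ∎

  Spans : Elt → Elt → Set ℓ'
  Spans C x = r (C ∨ x) ≈ r C

  rank-preserving-bound : ∀ C n (e : Fin n → Elt) →
    ∃[ J ] C ≤ᴸ J × r J ≈ r C × (∀ i → Spans C (e i) → e i ≤ᴸ J)
  rank-preserving-bound C zero e = C , Lat.refl , refl , λ ()
  rank-preserving-bound C (suc n) e
    with rank-preserving-bound C n (λ i → e (fsuc i)) | r (C ∨ e fzero) ≟ r C
  ... | J , C≤J , rJ≈rC , bounds | no ¬spans₀ =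
    J , C≤J , rJ≈rC , λ { fzero spans₀ → contradiction spans₀ ¬spans₀ ; (fsuc i) → bounds i }
  ... | J , C≤J , rJ≈rC , bounds | yes spans₀ =
    (C ∨ e fzero) ∨ J ,
    Lat.trans C≤J (y≤x∨y _ J) ,
    rank-preserving-∨ (x≤x∨y C (e fzero)) C≤J spans₀ rJ≈rC ,
    λ { fzero _ → Lat.trans (y≤x∨y C (e fzero)) (x≤x∨y _ J)
      ; (fsuc i) spansᵢ → Lat.trans (bounds i spansᵢ) (y≤x∨y _ J) }

  closure-extensive : ∀ {C K} → IsClosureOf r C K → C ≤ᴸ K
  closure-extensive {C} (spanned≤K , _) = spanned≤K C (r-cong _ _ (∨-idempotent C))

  closure-rank-≤ : IsFinite → ∀ {C K} → IsClosureOf r C K → r K ≤ r C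
  closure-rank-≤ (n , e , enumerates) {C} {K} (_ , least)
    with rank-preserving-bound C n e
  ... | J , _ , rJ≈rC , bounds = begin
    r K  ≤⟨ increasing _ _ (least J spanned≤J) ⟩
    r J  ≈⟨ rJ≈rC ⟩
    r C  ∎
    where
    spanned≤J : ∀ x → Spans C x → x ≤ᴸ J
    spanned≤J x spans with enumerates x
    ... | i , x≈eᵢ = Lat.trans (Lat.reflexive x≈eᵢ)
      (bounds i (trans (r-cong _ _ (∨-cong Lat.Eq.refl (Lat.Eq.sym x≈eᵢ))) spans))

  cyclic-above : IsModular → ∀ {C K} → Cyclic r C → C ≤ᴸ K → r K ≤ r C → Cyclic r K
  cyclic-above modular {C} {K} cyclic C≤K rK≤rC H H⋖K@((H≤K , _) , _)
    with r K ≟ r H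
  ... | yes rK≈rH = inj₁ rK≈rH
  ... | no rK≉rH = inj₂ (x<y⇒0<y-x rH<rK , witness (cyclic (C ∧ H) (⋖-∧ modular H⋖K C≤K C≰H)))
    where
    rH<rK : r H < r K
    rH<rK = ≤∧≉⇒< (increasing _ _ H≤K) (λ rH≈rK → rK≉rH (sym rH≈rK))

    C≰H : ¬ (C ≤ᴸ H)
    C≰H C≤H = <⇒≱ rH<rK (begin r K ≤⟨ rK≤rC ⟩ r C ≤⟨ increasing _ _ C≤H ⟩ r H ∎)

    -- Covering only yields ¬ ¬ (C ∨ H ≈ K); the real order is decidable, hence stable.
    jump≤ : r K - r H ≤ r C - r (C ∧ H)
    jump≤ = decidable-stable (_ ≤? _) λ jump≰ → ⋖-∨-¬¬≈ H⋖K C≤K C≰H λ C∨H≈K → jump≰ (begin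
      r K - r H        ≈⟨ +-congʳ (r-cong _ _ C∨H≈K) ⟨
      r (C ∨ H) - r H  ≤⟨ submodular C H ⟩
      r C - r (C ∧ H)  ∎)

    witness : (r C ≈ r (C ∧ H)) ⊎
              (0# < r C - r (C ∧ H) ×
               ∃ λ a → IsAtom a × a ≤ᴸ C × ¬ (a ≤ᴸ C ∧ H) × (r C - r (C ∧ H) < r a)) →
              ∃ λ a → IsAtom a × a ≤ᴸ K × ¬ (a ≤ᴸ H) × (r K - r H < r a)
    witness (inj₁ rC≈r[C∧H]) = contradiction (x-y≤0⇒x≤y (begin
      r K - r H        ≤⟨ jump≤ ⟩
      r C - r (C ∧ H)  ≤⟨ x≤y⇒x-y≤0 (inj₂ rC≈r[C∧H]) ⟩
      0#               ∎)) (<⇒≱ rH<rK)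
    witness (inj₂ (_ , a , atom , a≤C , a≰C∧H , jump<ra)) =
      a , atom , Lat.trans a≤C C≤K , (λ a≤H → a≰C∧H (∧-greatest a≤C a≤H)) ,
      (begin-strict r K - r H ≤⟨ jump≤ ⟩ r C - r (C ∧ H) <⟨ jump<ra ⟩ r a ∎)

lemma4p8 : ∀ {c ℓ₁ ℓ₂ c' ℓ' : Level}
    (L : BoundedLattice c ℓ₁ ℓ₂) →
    LatticeNotions.IsFinite L →
    LatticeNotions.IsModular L →
    LatticeNotions.IsComplemented L →
    (R : RealNumbers c' ℓ') →
    (r : BoundedLattice.Carrier L → RealNumbers.Carrier R) →
    PolymatroidNotions.IsPolymatroid L R r →
    ∀ C → PolymatroidNotions.Cyclic L R r C →
    ∀ K → PolymatroidNotions.IsClosureOf L R r C K →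
    PolymatroidNotions.Cyclic L R r K
lemma4p8 L finite modular _ R r isPolymatroid C cyclic K closure =
  cyclic-above modular cyclic (closure-extensive closure) (closure-rank-≤ finite closure)
  where open PolymatroidProperties L R isPolymatroid
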